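{- Let $A$ be a finite alphabet with $|A| = a \ge 3$, let $n$ be a positive integer, and let $w = w_1 w_2\cdots w_N$ be a universal partial word for $A^n$. If $w_i = \diamond$, then $w_j = \diamond$ for every $j \in \{1,\dots,N\}$ with $j \equiv i \pmod n$. Equivalently, the frame of $w$ has period $n$.
   Context: A partial word over $A$ is a finite sequence of characters from $A \cup \{\diamond\}$, where $\diamond \notin A$ is a wild-card symbol; a word over $A$ contains no $\diamond$. $A^n$ denotes the set of words of length $n$ over $A$. For $x = x_1\cdots x_n \in A^n$ and a partial word $w = w_1\cdots w_N$, the position $i$ ($0 \le i \le N-n$) covers $x$ if $x_j = w_{i+j}$ for every $1\le j\le n$ with $w_{i+j}\in A$. A universal partial word for $A^n$ is a partial word $w$ such that every word in $A^n$ is covered by exactly one position of $w$. The frame of a partial word is the word over $\{\_,\diamond\}$ obtained by replacing every letter of $A$ by the symbol $\_$; a word $f$ has period $p$ if $f_i = f_j$ whenever $i\equiv j \pmod p$. -}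

module Defs where

open import Data.Nat using (ℕ; _+_; _≤_; _<_)
open import Data.Fin using (Fin; toℕ)
open import Data.Maybe using (Maybe; just; nothing)
open import Data.Vec using (Vec; lookup)
open import Data.Product using (Σ; _×_; ∃-syntax)
open import Relation.Binary.PropositionalEquality using (_≡_)
open import Data.Nat.DivMod using (_%_)
import Data.Nat
import Data.Fin
import Relation.Nullary
import Data.Unit

-- A partial word over the alphabet Fin a: a letter is `just c`, the wild-card ◇ is `nothing`.
PartialWord : ℕ → ℕ → Set
PartialWord a N = Vec (Maybe (Fin a)) N

-- The i-th symbol of w (0-based, natural-number index; ◇ beyond the end, never used).
symAt : ∀ {a N} → PartialWord a N → ℕ → Maybe (Fin a)
symAt {N = N} w i with Data.Nat._<?_ i N
... | Relation.Nullary.yes p = lookup w (Data.Fin.fromℕ< p)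
... | Relation.Nullary.no _ = nothing

Compatible : ∀ {a} → Maybe (Fin a) → Fin a → Set
Compatible nothing  c = Data.Unit.⊤
Compatible (just d) c = d ≡ c

Covers : ∀ {a N n} → PartialWord a N → ℕ → Vec (Fin a) n → Set
Covers {N = N} {n = n} w i x =
  (i + n ≤ N) × ((j : Fin n) → Compatible (symAt w (i + toℕ j)) (lookup x j))

Universal : ∀ {a N} → (n : ℕ) → PartialWord a N → Set
Universal {a} n w =
  (x : Vec (Fin a) n) →
    Σ ℕ λ i → Covers w i x × ((k : ℕ) → Covers w k x → k ≡ i)

-- Suppose w has a hole at k but a letter b at k + n, and let
-- y be the word read (holes filled arbitrarily) at positions k + 1, …, k + n − 1. Then y b is
-- covered at k + 1. For e ≠ b, y e cannot be covered at a position p + 1 > 0: otherwise p covers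
-- a word that k covers as well (thanks to the hole at k), so p = k and e = b. Hence all a − 1 ≥ 2
-- words y e with e ≠ b are covered at 0; two of them differ only in their last letter, which forces
-- a hole at position n − 1, so y b is covered at 0 as well, contradicting uniqueness. The mirror
-- argument (with the last position N − n in place of 0) shows that a hole at k + n forces one at k,
-- and holes therefore propagate in steps of ±n.

module Submission where

open import Defs
open import Data.Nat using (ℕ; _≤_; _<_; NonZero)
open import Data.Nat.DivMod using (_%_)
open import Data.Maybe using (nothing)
open import Relation.Binary.PropositionalEquality using (_≡_)

open import Data.Nat using (zero; suc; _+_; _*_; _∸_; s≤s; s≤s⁻¹; z<s; _≤?_)
open import Data.Nat.Properties
open import Data.Nat.DivMod using (_/_; m≡m%n+[m/n]*n)
open import Data.Fin as Fin using (Fin; toℕ; fromℕ<)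
open import Data.Fin.Properties using (toℕ<n; toℕ-fromℕ<)
open import Data.Maybe using (Maybe; just)
open import Data.Vec using (Vec; tabulate)
open import Data.Vec.Properties using (lookup∘tabulate)
open import Data.Product using (∃; _×_; _,_; proj₁)
open import Data.Empty using (⊥-elim; ⊥-elim-irr)
open import Data.Unit using (tt)
open import Function using (_∘_)
open import Relation.Nullary using (yes; no; does)
open import Relation.Nullary.Decidable using (dec-true; dec-false)
open import Data.Bool using (true; false; if_then_else_)
open import Relation.Binary.PropositionalEquality
  using (_≢_; refl; sym; trans; cong; subst; module ≡-Reasoning)

module _ {A : Set} where

  _[_]≔_ : (ℕ → A) → ℕ → A → ℕ → A
  (g [ t ]≔ e) s = if does (s ≟ t) then e else g s

  []≔-updates : ∀ g t e → (g [ t ]≔ e) t ≡ e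
  []≔-updates g t e rewrite dec-true (t ≟ t) refl = refl

  []≔-minimal : ∀ g {s t} e → s ≢ t → (g [ t ]≔ e) s ≡ g s
  []≔-minimal g {s} {t} e s≢t rewrite dec-false (s ≟ t) s≢t = refl

  []≔-overwrite : ∀ g t e e′ s → ((g [ t ]≔ e) [ t ]≔ e′) s ≡ (g [ t ]≔ e′) s
  []≔-overwrite g t e e′ s with does (s ≟ t)
  ... | true  = refl
  ... | false = refl

  _◂_ : A → (ℕ → A) → ℕ → A
  (c ◂ g) zero    = c
  (c ◂ g) (suc t) = g t

hole-compatible : ∀ {a} {s : Maybe (Fin a)} {c} → s ≡ nothing → Compatible s c
hole-compatible refl = tt

letter-compatible : ∀ {a} {s : Maybe (Fin a)} {b} → s ≡ just b → Compatible s b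
letter-compatible refl = refl

no-letter⇒nothing : ∀ {A : Set} {s : Maybe A} → (∀ {b} → s ≢ just b) → s ≡ nothing
no-letter⇒nothing {s = nothing} _       = refl
no-letter⇒nothing {s = just b}  ¬letter = ⊥-elim (¬letter refl)

two-compatible⇒nothing : ∀ {a} {s : Maybe (Fin a)} {e₁ e₂ : Fin a} →
  Compatible s e₁ → Compatible s e₂ → e₁ ≢ e₂ → s ≡ nothing
two-compatible⇒nothing {s = nothing} _  _  _     = refl
two-compatible⇒nothing {s = just d}  c₁ c₂ e₁≢e₂ = ⊥-elim (e₁≢e₂ (trans (sym c₁) c₂))

two-other-letters : ∀ {a} → 3 ≤ a → (b : Fin a) →
  ∃ λ e₁ → ∃ λ e₂ → e₁ ≢ b × e₂ ≢ b × e₁ ≢ e₂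
two-other-letters (s≤s (s≤s (s≤s _))) Fin.zero =
  Fin.suc Fin.zero , Fin.suc (Fin.suc Fin.zero) , (λ ()) , (λ ()) , (λ ())
two-other-letters (s≤s (s≤s (s≤s _))) (Fin.suc Fin.zero) =
  Fin.zero , Fin.suc (Fin.suc Fin.zero) , (λ ()) , (λ ()) , (λ ())
two-other-letters (s≤s (s≤s (s≤s _))) (Fin.suc (Fin.suc _)) =
  Fin.zero , Fin.suc Fin.zero , (λ ()) , (λ ()) , (λ ())

module _ {N n : ℕ} (P : ℕ → Set)
         (forward  : ∀ k → k + n < N → P k → P (k + n))
         (backward : ∀ k → k + n < N → P (k + n) → P k) where

  private
    +-next-multiple : ∀ r t → r + suc t * n ≡ r + t * n + n
    +-next-multiple r t = trans (cong (r +_) (+-comm n (t * n))) (sym (+-assoc r (t * n) n))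

    below-next : ∀ r t → r + suc t * n < N → r + t * n + n < N
    below-next r t = subst (_< N) (+-next-multiple r t)

    below-previous : ∀ r t → r + suc t * n < N → r + t * n < N
    below-previous r t bound = ≤-<-trans (m≤m+n (r + t * n) n) (below-next r t bound)

  up-by-multiples : ∀ r t → r + t * n < N → P r → P (r + t * n)
  up-by-multiples r zero    _     Pr = subst P (sym (+-identityʳ r)) Pr
  up-by-multiples r (suc t) bound Pr =
    subst P (sym (+-next-multiple r t))
      (forward (r + t * n) (below-next r t bound) (up-by-multiples r t (below-previous r t bound) Pr))

  down-by-multiples : ∀ r t → r + t * n < N → P (r + t * n) → P r
  down-by-multiples r zero    _     P-shifted = subst P (+-identityʳ r) P-shifted
  down-by-multiples r (suc t) bound P-shifted =
    down-by-multiples r t (below-previous r t bound)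
      (backward (r + t * n) (below-next r t bound) (subst P (+-next-multiple r t) P-shifted))

  periodic-below : .{{_ : NonZero n}} → ∀ {i j} → i < N → j < N → i % n ≡ j % n → P i → P j
  periodic-below {i} {j} i<N j<N i≡j Pi =
    subst P (sym j-divmod) (up-by-multiples (i % n) (j / n) (subst (_< N) j-divmod j<N) P-remainder)
    where
    i-divmod : i ≡ i % n + i / n * n
    i-divmod = m≡m%n+[m/n]*n i n

    j-divmod : j ≡ i % n + j / n * n
    j-divmod = trans (m≡m%n+[m/n]*n j n) (cong (_+ j / n * n) (sym i≡j))

    P-remainder : P (i % n)
    P-remainder = down-by-multiples (i % n) (i / n) (subst (_< N) i-divmod i<N) (subst P i-divmod Pi)

module Windows {a N : ℕ} (m : ℕ) (w : PartialWord (suc a) N) where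

  n : ℕ
  n = suc m

  Letter : Set
  Letter = Fin (suc a)

  Fits : ℕ → (ℕ → Letter) → Set
  Fits p g = p + n ≤ N × (∀ t → t < n → Compatible (symAt w (p + t)) (g t))

  window : (ℕ → Letter) → Vec Letter n
  window g = tabulate (g ∘ toℕ)

  fits⇒covers : ∀ {p g} → Fits p g → Covers w p (window g)
  fits⇒covers {p} {g} (room , fit) =
    room , λ j → subst (Compatible (symAt w (p + toℕ j)))
                   (sym (lookup∘tabulate (g ∘ toℕ) j)) (fit (toℕ j) (toℕ<n j))

  covers⇒fits : ∀ {p g} → Covers w p (window g) → Fits p g
  covers⇒fits {p} {g} (room , cover) = room , fit
    where
    fit : ∀ t → t < n → Compatible (symAt w (p + t)) (g t)
    fit t t<n with cover (fromℕ< t<n)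
    ... | c rewrite lookup∘tabulate (g ∘ toℕ) (fromℕ< t<n) | toℕ-fromℕ< t<n = c

  completion : ℕ → Letter
  completion k with symAt w k
  ... | just d  = d
  ... | nothing = Fin.zero

  completion-compatible : ∀ k → Compatible (symAt w k) (completion k)
  completion-compatible k with symAt w k
  ... | just d  = refl
  ... | nothing = tt

  completion-fits : ∀ {p} → p + n ≤ N → Fits p (completion ∘ (p +_))
  completion-fits {p} room = room , λ t _ → completion-compatible (p + t)

  fits-cong : ∀ {p g h} → (∀ t → t < n → g t ≡ h t) → Fits p g → Fits p h
  fits-cong {p} g≐h (room , fit) =
    room , λ t t<n → subst (Compatible (symAt w (p + t))) (g≐h t t<n) (fit t t<n)

  fits-[]≔ : ∀ {p g t e} → Fits p g → Compatible (symAt w (p + t)) e → Fits p (g [ t ]≔ e)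
  fits-[]≔ {p} {g} {t} {e} (room , fit) fit-e = room , fit′
    where
    fit′ : ∀ s → s < n → Compatible (symAt w (p + s)) ((g [ t ]≔ e) s)
    fit′ s s<n with s ≟ t
    ... | yes refl rewrite []≔-updates g s e = fit-e
    ... | no s≢t   rewrite []≔-minimal g e s≢t = fit s s<n

  fits-◂ : ∀ {p g c} → Fits (suc p) g → Compatible (symAt w p) c → Fits p (c ◂ g)
  fits-◂ {p} {g} {c} (room , fit) fit-c = <⇒≤ room , fit′
    where
    fit′ : ∀ t → t < n → Compatible (symAt w (p + t)) ((c ◂ g) t)
    fit′ zero    _   rewrite +-identityʳ p = fit-c
    fit′ (suc t) t<n rewrite +-suc p t = fit t (<-trans (n<1+n t) t<n)

  fits-slide : ∀ {p g c} → Fits p g → suc p + n ≤ N → Compatible (symAt w (p + n)) c →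
               Fits (suc p) ((g ∘ suc) [ m ]≔ c)
  fits-slide {p} {g} {c} (_ , fit) room fit-c = room , fit′
    where
    fit′ : ∀ t → t < n → Compatible (symAt w (suc p + t)) (((g ∘ suc) [ m ]≔ c) t)
    fit′ t t<n with t ≟ m
    ... | yes refl rewrite []≔-updates (g ∘ suc) t c | sym (+-suc p t) = fit-c
    ... | no t≢m   rewrite []≔-minimal (g ∘ suc) c t≢m | sym (+-suc p t) =
      fit (suc t) (s≤s (≤∧≢⇒< (s≤s⁻¹ t<n) t≢m))

  module _ (universal : Universal n w) where

    fits-somewhere : ∀ g → ∃ λ p → Fits p g
    fits-somewhere g with universal (window g)
    ... | p , cover , _ = p , covers⇒fits cover

    fits-unique : ∀ {p q g} → Fits p g → Fits q g → p ≡ q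
    fits-unique {p} {q} {g} fit-p fit-q with universal (window g)
    ... | _ , _ , unique = trans (unique p (fits⇒covers fit-p)) (sym (unique q (fits⇒covers fit-q)))

    -- As a ≥ 3, two distinct letters e ≠ b exist; their windows both fit at p₀ and differ only
    -- at t, so w has a hole at p₀ + t.
    forced-fit : 3 ≤ suc a → ∀ g {t} b p₀ → t < n →
                 (∀ e → e ≢ b → ∀ p → Fits p (g [ t ]≔ e) → p ≡ p₀) →
                 Fits p₀ (g [ t ]≔ b)
    forced-fit 3≤a g {t} b p₀ t<n only-p₀ with two-other-letters 3≤a b
    ... | e₁ , e₂ , e₁≢b , e₂≢b , e₁≢e₂ =
      fits-cong (λ s _ → []≔-overwrite g t e₁ b s)
        (fits-[]≔ (fit-at-p₀ e₁≢b) (hole-compatible hole))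
      where
      fit-at-p₀ : ∀ {e} → e ≢ b → Fits p₀ (g [ t ]≔ e)
      fit-at-p₀ {e} e≢b with fits-somewhere (g [ t ]≔ e)
      ... | p , fit = subst (λ q → Fits q (g [ t ]≔ e)) (only-p₀ e e≢b p fit) fit

      letter-at : ∀ {e} → Fits p₀ (g [ t ]≔ e) → Compatible (symAt w (p₀ + t)) e
      letter-at {e} (_ , fit) = subst (Compatible (symAt w (p₀ + t))) ([]≔-updates g t e) (fit t t<n)

      hole : symAt w (p₀ + t) ≡ nothing
      hole = two-compatible⇒nothing (letter-at (fit-at-p₀ e₁≢b)) (letter-at (fit-at-p₀ e₂≢b)) e₁≢e₂

    no-letter-n-after-hole : 3 ≤ suc a → ∀ {k b} → k + n < N →
                             symAt w k ≡ nothing → symAt w (k + n) ≢ just b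
    no-letter-n-after-hole 3≤a {k} {b} room hole letter =
      0≢1+n (fits-unique (forced-fit 3≤a y b 0 (n<1+n m) only-at-0) fits-b)
      where
      y : ℕ → Letter
      y = completion ∘ (suc k +_)

      letter′ : symAt w (suc k + m) ≡ just b
      letter′ = trans (cong (symAt w) (sym (+-suc k m))) letter

      fits-b : Fits (suc k) (y [ m ]≔ b)
      fits-b = fits-[]≔ (completion-fits room) (letter-compatible letter′)

      last-letter : ∀ {e} → Fits (suc k) (y [ m ]≔ e) → b ≡ e
      last-letter {e} (_ , fit) with fit m (n<1+n m)
      ... | c rewrite []≔-updates y m e | letter′ = c

      fits-after-hole : ∀ e c → Fits k (c ◂ (y [ m ]≔ e))
      fits-after-hole e c = fits-cong agree (fits-◂ (completion-fits room) (hole-compatible hole))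
        where
        agree : ∀ t → t < n → (c ◂ y) t ≡ (c ◂ (y [ m ]≔ e)) t
        agree zero    _   = refl
        agree (suc t) t<n = sym ([]≔-minimal y e (<⇒≢ (s≤s⁻¹ t<n)))

      -- A later position p + 1 would push the window back onto the hole at k.
      only-at-0 : ∀ e → e ≢ b → ∀ p → Fits p (y [ m ]≔ e) → p ≡ 0
      only-at-0 e e≢b zero    _   = refl
      only-at-0 e e≢b (suc p) fit
        with fits-unique (fits-◂ fit (completion-compatible p)) (fits-after-hole e (completion p))
      ... | refl = ⊥-elim (e≢b (sym (last-letter fit)))

    no-letter-n-before-hole : 3 ≤ suc a → ∀ {k b} → k + n < N →
                              symAt w (k + n) ≡ nothing → symAt w k ≢ just b
    no-letter-n-before-hole 3≤a {k} {b} room hole letter =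
      <-irrefl (fits-unique fits-b (forced-fit 3≤a x b (N ∸ n) z<s only-at-end))
               (m+n≤o⇒m≤o∸n (suc k) room)
      where
      x : ℕ → Letter
      x = completion ∘ (k +_)

      letter′ : symAt w (k + 0) ≡ just b
      letter′ = trans (cong (symAt w) (+-identityʳ k)) letter

      fits-b : Fits k (x [ 0 ]≔ b)
      fits-b = fits-[]≔ (completion-fits (<⇒≤ room)) (letter-compatible letter′)

      first-letter : ∀ {e} → Fits k (x [ 0 ]≔ e) → b ≡ e
      first-letter {e} (_ , fit) with fit 0 z<s
      ... | c rewrite []≔-updates x 0 e | letter′ = c

      fits-before-hole : ∀ c → Fits (suc k) ((x ∘ suc) [ m ]≔ c)
      fits-before-hole c = fits-slide (completion-fits (<⇒≤ room)) room (hole-compatible hole)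

      -- An earlier position p < N ∸ n would slide the window forward onto the hole at k + n.
      only-at-end : ∀ e → e ≢ b → ∀ p → Fits p (x [ 0 ]≔ e) → p ≡ N ∸ n
      only-at-end e e≢b p fit with suc p + n ≤? N
      ... | no no-room = begin
        p          ≡⟨ m+n∸n≡m p n ⟨
        p + n ∸ n  ≡⟨ cong (_∸ n) (≤-antisym (proj₁ fit) (≮⇒≥ no-room)) ⟩
        N ∸ n      ∎
        where open ≡-Reasoning
      ... | yes room′
        with fits-unique (fits-slide fit room′ (completion-compatible (p + n)))
                         (fits-before-hole (completion (p + n)))
      ...   | refl = ⊥-elim (e≢b (sym (first-letter fit)))

theorem4p1 : (a n N : ℕ) → 3 ≤ a → .{{_ : NonZero n}} →
    (w : PartialWord a N) → Universal n w →
    (i j : ℕ) → i < N → j < N → i % n ≡ j % n →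
    symAt w i ≡ nothing → symAt w j ≡ nothing
theorem4p1 a zero N _ {{nonZero}} = ⊥-elim-irr (NonZero.nonZero nonZero)
theorem4p1 zero (suc _) _ ()
theorem4p1 (suc a) (suc m) N 3≤a w universal i j i<N j<N i≡j =
  periodic-below (λ k → symAt w k ≡ nothing)
    (λ k room hole → no-letter⇒nothing (no-letter-n-after-hole universal 3≤a room hole))
    (λ k room hole → no-letter⇒nothing (no-letter-n-before-hole universal 3≤a room hole))
    i<N j<N i≡j
  where open Windows m w
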